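{- Let $p$ be an odd prime, $e\ge1$, $q=p^{2e}$, and let $n$ be a positive integer. Let $M'(n,0,0)$ denote the number of $n$-element subsets $\{x_1,\dots,x_n\}$ of $\mathbb{F}_q$ satisfying $$\sum_{1\le i<j\le n}x_ix_j=0,\qquad \sum_{1\le i\le n}x_i=0,$$ and let $M(n,0,0)$ denote the number of $n$-element subsets $\{x_1,\dots,x_n\}$ of $\mathbb{F}_q$ satisfying $$x_1^2+\cdots+x_n^2=0,\qquad x_1+\cdots+x_n=0.$$ Then $M'(n,0,0)=M(n,0,0)$. -}

module Defs where

open import Level using (Level; _⊔_) renaming (suc to lsuc)
open import Algebra.Bundles using (CommutativeRing)
open import Data.Nat using (ℕ; zero; suc; _≟_)
open import Data.Fin using (Fin)
import Data.Fin as Fin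
open import Data.Fin.Subset using (Subset; ∣_∣)
open import Data.Vec using (Vec; []; _∷_)
open import Data.Bool using (Bool; true; false; _∧_)
open import Data.List using (List; []; _∷_; _++_; map; length)
open import Data.Product using (∃)
open import Relation.Nullary using (¬_; does)
open import Relation.Binary using (Decidable)
open import Relation.Binary.PropositionalEquality using (_≡_)

record FiniteField (c ℓ : Level) : Set (lsuc (c ⊔ ℓ)) where
  field
    commRing : CommutativeRing c ℓ
  open CommutativeRing commRing public
  field
    _≈?_            : Decidable _≈_
    1≉0             : ¬ (1# ≈ 0#)
    inverse         : ∀ x → ¬ (x ≈ 0#) → ∃ λ y → x * y ≈ 1#
    size            : ℕ
    enum            : Fin size → Carrier
    enum-injective  : ∀ i j → enum i ≈ enum j → i ≡ j
    enum-surjective : ∀ x → ∃ λ i → enum i ≈ x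

  _×1 : ℕ → Carrier
  zero ×1  = 0#
  suc n ×1 = 1# + (n ×1)

  sumL : List Carrier → Carrier
  sumL []       = 0#
  sumL (x ∷ xs) = x + sumL xs

  sumSqL : List Carrier → Carrier
  sumSqL []       = 0#
  sumSqL (x ∷ xs) = x * x + sumSqL xs

  e₂L : List Carrier → Carrier
  e₂L []       = 0#
  e₂L (x ∷ xs) = x * sumL xs + e₂L xs

  allSubsets : (k : ℕ) → List (Subset k)
  allSubsets zero    = [] ∷ []
  allSubsets (suc k) = map (true ∷_) (allSubsets k) ++ map (false ∷_) (allSubsets k)

  elemsVia : ∀ {k} → (Fin k → Carrier) → Subset k → List Carrier
  elemsVia f []            = []
  elemsVia f (true ∷ s)    = f Fin.zero ∷ elemsVia (λ i → f (Fin.suc i)) s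
  elemsVia f (false ∷ s)   = elemsVia (λ i → f (Fin.suc i)) s

  -- the elements of the subset S of F (subsets of F identified with subsets of Fin size via enum)
  elems : Subset size → List Carrier
  elems = elemsVia enum

  countB : ∀ {a} {A : Set a} → (A → Bool) → List A → ℕ
  countB b []       = 0
  countB b (x ∷ xs) with b x
  ... | true  = suc (countB b xs)
  ... | false = countB b xs

  isZero : Carrier → Bool
  isZero x = does (x ≈? 0#)

  M′ : ℕ → ℕ
  M′ n = countB (λ S → does (∣ S ∣ ≟ n) ∧ isZero (e₂L (elems S)) ∧ isZero (sumL (elems S)))
                 (allSubsets size)

  M : ℕ → ℕ
  M n = countB (λ S → does (∣ S ∣ ≟ n) ∧ isZero (sumSqL (elems S)) ∧ isZero (sumL (elems S)))
               (allSubsets size)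

-- The argument is the polynomial identity
--     (Σ x_i)² = Σ x_i² + 2 · Σ_{i<j} x_i x_j ,
-- valid in every commutative ring.  When Σ x_i = 0 it says Σ x_i² = -2 e₂,
-- and since 2 is invertible in odd characteristic, Σ x_i² = 0 iff e₂ = 0.
module Submission where

open import Defs
open import Level using (Level)
open import Data.Nat using (ℕ; zero; suc; _≥_; _^_; _≟_)
import Data.Nat as ℕ
open import Data.Nat.Primality using (Prime; prime⇒irreducible)
open import Data.Nat.Divisibility using (_∣_; ∣-refl; _∣0; ∣m∣n⇒∣m+n)
open import Data.Fin.Subset using (∣_∣)
open import Data.Bool using (Bool; true; false; _∧_)
open import Data.Bool.Properties using (∧-zeroʳ)
open import Data.List using ([]; _∷_)
open import Data.Product using (_,_)
open import Data.Sum using (inj₁; inj₂)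
open import Data.Empty using (⊥-elim)
open import Function using (_⇔_; mk⇔; Equivalence)
open import Relation.Nullary using (¬_; does; yes; no)
open import Relation.Binary.PropositionalEquality as P using (_≡_)
import Algebra.Solver.Ring.NaturalCoefficients.Default as SemiringSolver
import Relation.Binary.Reasoning.Setoid as SetoidReasoning

module FieldFacts {c ℓ : Level} (F : FiniteField c ℓ) where
  open FiniteField F
  open SetoidReasoning setoid
  open SemiringSolver commutativeSemiring using (solve; _:+_; _:*_; _:=_)

  countB-cong : ∀ {a} {A : Set a} (f g : A → Bool) → (∀ x → f x ≡ g x) →
                ∀ xs → countB f xs ≡ countB g xs
  countB-cong f g f≗g []       = P.refl
  countB-cong f g f≗g (x ∷ xs) with f x | g x | f≗g x
  ... | true  | .true  | P.refl = P.cong suc (countB-cong f g f≗g xs)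
  ... | false | .false | P.refl = countB-cong f g f≗g xs

  two : Carrier
  two = 1# + 1#

  two*≈double : ∀ z → two * z ≈ z + z
  two*≈double z = trans (distribʳ z 1# 1#) (+-cong (*-identityˡ z) (*-identityˡ z))

  regroup : ∀ x s sq e → (x * x + sq) + ((x * s + e) + (x * s + e))
                       ≈ (x * x + (x * s + x * s)) + (sq + (e + e))
  regroup = solve 4 (λ x s sq e →
    (x :* x :+ sq) :+ ((x :* s :+ e) :+ (x :* s :+ e)) :=
    (x :* x :+ (x :* s :+ x :* s)) :+ (sq :+ (e :+ e))) refl

  binomial : ∀ x s → (x * x + (x * s + x * s)) + s * s ≈ (x + s) * (x + s)
  binomial = solve 2 (λ x s →
    (x :* x :+ (x :* s :+ x :* s)) :+ s :* s := (x :+ s) :* (x :+ s)) refl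

  square-of-sum : ∀ xs → sumSqL xs + (e₂L xs + e₂L xs) ≈ sumL xs * sumL xs
  square-of-sum [] = trans (+-identityˡ _) (trans (+-identityˡ _) (sym (zeroˡ _)))
  square-of-sum (x ∷ xs) = begin
      (x * x + sq) + ((x * s + e) + (x * s + e)) ≈⟨ regroup x s sq e ⟩
      (x * x + (x * s + x * s)) + (sq + (e + e)) ≈⟨ +-cong refl (square-of-sum xs) ⟩
      (x * x + (x * s + x * s)) + s * s         ≈⟨ binomial x s ⟩
      (x + s) * (x + s)                         ∎
    where
    s = sumL xs ; sq = sumSqL xs ; e = e₂L xs

  char-two⇒even : two ≈ 0# → ∀ n → n ×1 ≈ 0# → 2 ∣ n
  char-two⇒even two≈0 zero          _    = 2 ∣0
  char-two⇒even two≈0 (suc zero)    1≈0  = ⊥-elim (1≉0 (trans (sym (+-identityʳ 1#)) 1≈0))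
  char-two⇒even two≈0 (suc (suc n)) n+2≈0 =
    ∣m∣n⇒∣m+n ∣-refl (char-two⇒even two≈0 n (trans (sym n+2≈n) n+2≈0))
    where
    n+2≈n : suc (suc n) ×1 ≈ n ×1
    n+2≈n = trans (sym (+-assoc 1# 1# (n ×1))) (trans (+-cong two≈0 refl) (+-identityˡ _))

  odd-char⇒two≉0 : ∀ p → Prime p → ¬ (p ≡ 2) → p ×1 ≈ 0# → ¬ (two ≈ 0#)
  odd-char⇒two≉0 p p-prime p≢2 p≈0 two≈0
    with prime⇒irreducible p-prime (char-two⇒even two≈0 p p≈0)
  ... | inj₁ ()
  ... | inj₂ 2≡p = p≢2 (P.sym 2≡p)

  halve-zero : ¬ (two ≈ 0#) → ∀ z → z + z ≈ 0# → z ≈ 0#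
  halve-zero two≉0 z z+z≈0 with inverse two two≉0
  ... | y , two*y≈1 = begin
      z                ≈⟨ sym (*-identityˡ z) ⟩
      1# * z           ≈⟨ *-cong (trans (sym two*y≈1) (*-comm two y)) refl ⟩
      (y * two) * z    ≈⟨ *-assoc y two z ⟩
      y * (two * z)    ≈⟨ *-cong refl (trans (two*≈double z) z+z≈0) ⟩
      y * 0#           ≈⟨ zeroʳ y ⟩
      0#               ∎

  e₂≈0⇔sumSq≈0 : ¬ (two ≈ 0#) → ∀ xs → sumL xs ≈ 0# →
                 (e₂L xs ≈ 0#) ⇔ (sumSqL xs ≈ 0#)
  e₂≈0⇔sumSq≈0 two≉0 xs sum≈0 = mk⇔ e₂≈0⇒sumSq≈0 sumSq≈0⇒e₂≈0
    where
    total≈0 : sumSqL xs + (e₂L xs + e₂L xs) ≈ 0#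
    total≈0 = trans (square-of-sum xs) (trans (*-cong sum≈0 refl) (zeroˡ _))

    e₂≈0⇒sumSq≈0 : e₂L xs ≈ 0# → sumSqL xs ≈ 0#
    e₂≈0⇒sumSq≈0 e₂≈0 = begin
      sumSqL xs                           ≈⟨ sym (+-identityʳ _) ⟩
      sumSqL xs + 0#                      ≈⟨ +-cong refl (sym (trans (+-cong e₂≈0 e₂≈0) (+-identityʳ 0#))) ⟩
      sumSqL xs + (e₂L xs + e₂L xs)       ≈⟨ total≈0 ⟩
      0#                                  ∎

    sumSq≈0⇒e₂≈0 : sumSqL xs ≈ 0# → e₂L xs ≈ 0#
    sumSq≈0⇒e₂≈0 sumSq≈0 = halve-zero two≉0 (e₂L xs) (begin
      e₂L xs + e₂L xs                     ≈⟨ sym (+-identityˡ _) ⟩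
      0# + (e₂L xs + e₂L xs)              ≈⟨ +-cong (sym sumSq≈0) refl ⟩
      sumSqL xs + (e₂L xs + e₂L xs)       ≈⟨ total≈0 ⟩
      0#                                  ∎)

  zero-tests-agree : ∀ x y z → (z ≈ 0# → (x ≈ 0#) ⇔ (y ≈ 0#)) →
                     isZero x ∧ isZero z ≡ isZero y ∧ isZero z
  zero-tests-agree x y z equiv with z ≈? 0#
  ... | no _ = P.trans (∧-zeroʳ _) (P.sym (∧-zeroʳ _))
  ... | yes z≈0 with x ≈? 0# | y ≈? 0#
  ...   | yes _   | yes _   = P.refl
  ...   | no _    | no _    = P.refl
  ...   | yes x≈0 | no y≉0  = ⊥-elim (y≉0 (Equivalence.to (equiv z≈0) x≈0))
  ...   | no x≉0  | yes y≈0 = ⊥-elim (x≉0 (Equivalence.from (equiv z≈0) y≈0))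

corollary4p1 : ∀ {c ℓ : Level} (F : FiniteField c ℓ) (p e : ℕ) →
    Prime p → ¬ (p ≡ 2) → e ≥ 1 →
    FiniteField.size F ≡ p ^ (2 ℕ.* e) →
    FiniteField._≈_ F (FiniteField._×1 F p) (FiniteField.0# F) →
    (n : ℕ) → n ≥ 1 →
    FiniteField.M′ F n ≡ FiniteField.M F n
corollary4p1 F p _ p-prime p≢2 _ _ p≈0 n _ =
  countB-cong _ _ same-test (allSubsets size)
  where
  open FiniteField F
  open FieldFacts F

  two≉0 : ¬ (two ≈ 0#)
  two≉0 = odd-char⇒two≉0 p p-prime p≢2 p≈0

  same-test : ∀ S → does (∣ S ∣ ≟ n) ∧ isZero (e₂L (elems S)) ∧ isZero (sumL (elems S))
                  ≡ does (∣ S ∣ ≟ n) ∧ isZero (sumSqL (elems S)) ∧ isZero (sumL (elems S))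
  same-test S = P.cong (does (∣ S ∣ ≟ n) ∧_)
    (zero-tests-agree _ _ _ (e₂≈0⇔sumSq≈0 two≉0 (elems S)))
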